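{- Let $G$, $H$ be finite groups and $m\geqslant2$. Then there is a homogeneous graph isomorphism between $\mathscr{G}_m(G)$ and $\mathscr{G}_m(H)$ if and only if the groups $G$ and $H$ are isomorphic.
   Context: For a finite group $G$ with identity $e$, $G^\times=G\setminus\{e\}$. For $x\in G^\times$ and $1\leqslant k<l\leqslant m+1$, $\mathbf{x}_{[k,l)}\in G^m$ has $j$-th coordinate $x$ for $k\leqslant j<l$ and $e$ otherwise; the interval $\mathcal{S}_{[k,l)}(G)=\{\mathbf{x}_{[k,l)}:x\in G^\times\}$, $\mathcal{S}$ is the union of all intervals, and $\mathscr{G}_m(G)=Cay(G^m,\mathcal{S})$ is the graph on $G^m$ with $\mathbf{g}\sim\mathbf{h}$ iff $\mathbf{h}\mathbf{g}^{ -1}\in\mathcal{S}$. A graph homomorphism (isomorphism) $F\colon\mathscr{G}_m(G)\to\mathscr{G}_m(H)$ is homogeneous if $F(\mathbf{e}_G)=\mathbf{e}_H$ (the identity tuples) and $F(\mathcal{S}_{[k,l)}(G))\subseteq\mathcal{S}_{[k,l)}(H)$ for all $1\leqslant k<l\leqslant m+1$. -}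

module Defs where

open import Level using (Level; _⊔_)
open import Data.Nat using (ℕ; _<_; _≤_)
open import Data.Fin using (Fin; toℕ)
open import Data.Product using (Σ; ∃; _×_; _,_)
open import Relation.Nullary using (¬_; Dec; yes; no)
open import Relation.Binary.PropositionalEquality as ≡ using (_≡_)
open import Function.Bundles using (Inverse)
open import Algebra.Bundles using (Group)
open import Algebra.Morphism.Structures using (module GroupMorphisms)
open import Data.Nat.Properties using (_≤?_; _<?_)
open import Data.Product using (_×_)
open import Relation.Nullary.Decidable using (_×-dec_)

private variable c ℓ c' ℓ' : Level

IsFiniteGroup : Group c ℓ → Set (c ⊔ ℓ)
IsFiniteGroup G = Σ ℕ λ n → Inverse (≡.setoid (Fin n)) (Group.setoid G)

GroupIsomorphic : Group c ℓ → Group c' ℓ' → Set (c ⊔ c' ⊔ ℓ ⊔ ℓ')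
GroupIsomorphic G H =
  Σ (Group.Carrier G → Group.Carrier H)
    (GroupMorphisms.IsGroupIsomorphism (Group.rawGroup G) (Group.rawGroup H))

module _ (G : Group c ℓ) (m : ℕ) where
  open Group G

  Tuple : Set c
  Tuple = Fin m → Carrier

  _≈ᵗ_ : Tuple → Tuple → Set ℓ
  g ≈ᵗ h = ∀ j → g j ≈ h j

  eᵗ : Tuple
  eᵗ _ = ε

  _·ᵗ_ : Tuple → Tuple → Tuple
  (g ·ᵗ h) j = g j ∙ h j

  invᵗ : Tuple → Tuple
  invᵗ g j = g j ⁻¹

  -- Valid 0-based interval bounds: k < l ≤ m  (the paper's 1 ≤ k < l ≤ m+1, shifted by one).
  ValidInterval : ℕ → ℕ → Set
  ValidInterval k l = k < l × l ≤ m

  intervalElem : ℕ → ℕ → Carrier → Tuple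
  intervalElem k l x j with (k ≤? toℕ j) ×-dec (toℕ j <? l)
  ... | yes _ = x
  ... | no  _ = ε

  InInterval : ℕ → ℕ → Tuple → Set (c ⊔ ℓ)
  InInterval k l t = Σ Carrier λ x → (¬ (x ≈ ε)) × (t ≈ᵗ intervalElem k l x)

  InS : Tuple → Set (c ⊔ ℓ)
  InS t = Σ ℕ λ k → Σ ℕ λ l → ValidInterval k l × InInterval k l t

  -- adjacency in 𝒢_m(G) = Cay(G^m, S):  g ∼ h  iff  h g⁻¹ ∈ S
  Adj : Tuple → Tuple → Set (c ⊔ ℓ)
  Adj g h = InS (h ·ᵗ invᵗ g)

record GraphIso (G : Group c ℓ) (H : Group c' ℓ') (m : ℕ) : Set (c ⊔ c' ⊔ ℓ ⊔ ℓ') where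
  field
    to      : Tuple G m → Tuple H m
    from    : Tuple H m → Tuple G m
    to-cong   : ∀ {g g'} → _≈ᵗ_ G m g g' → _≈ᵗ_ H m (to g) (to g')
    from-cong : ∀ {h h'} → _≈ᵗ_ H m h h' → _≈ᵗ_ G m (from h) (from h')
    to-from : ∀ h → _≈ᵗ_ H m (to (from h)) h
    from-to : ∀ g → _≈ᵗ_ G m (from (to g)) g
    adj-iff₁ : ∀ g g' → Adj G m g g' → Adj H m (to g) (to g')
    adj-iff₂ : ∀ g g' → Adj H m (to g) (to g') → Adj G m g g'

IsHomogeneous : (G : Group c ℓ) (H : Group c' ℓ') (m : ℕ) → GraphIso G H m → Set (c ⊔ c' ⊔ ℓ ⊔ ℓ')
IsHomogeneous G H m F =
  _≈ᵗ_ H m (GraphIso.to F (eᵗ G m)) (eᵗ H m) ×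
  (∀ k l → ValidInterval G m k l → ∀ t →
     InInterval G m k l t → InInterval H m k l (GraphIso.to F t))

HomogeneousGraphIsomorphic : (G : Group c ℓ) (H : Group c' ℓ') (m : ℕ) → Set (c ⊔ c' ⊔ ℓ ⊔ ℓ')
HomogeneousGraphIsomorphic G H m = Σ (GraphIso G H m) (IsHomogeneous G H m)

-- A homogeneous isomorphism F keeps every interval element inside its interval, so
-- φ x, the first coordinate of F (x , e , e , …), satisfies F (x , e , …) = (φ x , e , …),
-- F (x , x , e , …) = (φ x , φ x , e , …) and F (e , x , e , …) = (e , φ x , e , …), and φ is a
-- bijection. An element of S takes a single non-identity value, so any two of its coordinates are
-- concordant: one of them is e or they are equal. Applying this to the differences between
-- h = F (a , b , e , …) and the images of the neighbours (a , e), (a , a), (e , b), (b , b) and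
-- (e , a⁻¹ b) of (a , b) forces φ (a⁻¹ b) = (φ a)⁻¹ φ b, so φ is a homomorphism. Conversely, a group
-- isomorphism applied coordinatewise is a homogeneous graph isomorphism. Finiteness is used only to
-- decide equality.

module Submission where

open import Defs
open import Data.Nat using (ℕ; zero; suc; _≤_; z≤n; s≤s)
open import Data.Nat.Properties using (_≤?_; _<?_)
open import Data.Fin using (zero; suc; toℕ)
open import Data.Fin.Properties using (inj⇒≟)
open import Data.Product using (Σ; _×_; _,_; proj₁; proj₂; swap)
open import Data.Sum using (_⊎_; inj₁; inj₂)
open import Data.Empty using (⊥-elim)
open import Function using (_∘_)
open import Relation.Nullary using (¬_; yes; no)
open import Relation.Nullary.Decidable using (_×-dec_)
open import Relation.Binary.Definitions using (Decidable)
open import Relation.Binary.PropositionalEquality as ≡ using (_≡_)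
open import Function.Bundles using (_⇔_; mk⇔; Equivalence)
open import Function.Properties.Inverse using (Inverse⇒Injection)
import Function.Construct.Symmetry as Symmetry
open import Algebra.Bundles using (Group)
open import Algebra.Morphism.Structures using (module GroupMorphisms)
import Algebra.Properties.Group as GroupProperties

finite⇒≟ : ∀ {a ℓ} (G : Group a ℓ) → IsFiniteGroup G → Decidable (Group._≈_ G)
finite⇒≟ G (_ , Fin↔G) = inj⇒≟ (Inverse⇒Injection (Symmetry.inverse Fin↔G))

module GroupFacts {a ℓ} (G : Group a ℓ) where
  open Group G
  open GroupProperties G

  private variable x y : Carrier

  x∙ε⁻¹≈x : ∀ x → x ∙ ε ⁻¹ ≈ x
  x∙ε⁻¹≈x x = trans (∙-congˡ ε⁻¹≈ε) (identityʳ x)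

  x⁻¹≈ε⇒x≈ε : x ⁻¹ ≈ ε → x ≈ ε
  x⁻¹≈ε⇒x≈ε x⁻¹≈ε = ⁻¹-injective (trans x⁻¹≈ε (sym ε⁻¹≈ε))

  x≉ε⇒x⁻¹≉ε : ¬ x ≈ ε → ¬ x ⁻¹ ≈ ε
  x≉ε⇒x⁻¹≉ε x≉ε = x≉ε ∘ x⁻¹≈ε⇒x≈ε

  x∙y⁻¹≈x⇒y≈ε : x ∙ y ⁻¹ ≈ x → y ≈ ε
  x∙y⁻¹≈x⇒y≈ε {x} {y} e = x⁻¹≈ε⇒x≈ε (identityʳ-unique x (y ⁻¹) e)

  x≈z∙y⁻¹⇒x∙y≈z : ∀ {x y z} → x ≈ z ∙ y ⁻¹ → x ∙ y ≈ z
  x≈z∙y⁻¹⇒x∙y≈z {y = y} {z} e = trans (∙-congʳ e) (//-rightDividesˡ y z)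

module Concordance {a ℓ} (G : Group a ℓ) where
  open Group G
  open GroupProperties G
  open GroupFacts G

  Concordant : Carrier → Carrier → Set ℓ
  Concordant p q = p ≈ ε ⊎ q ≈ ε ⊎ p ≈ q

  private variable p p' q q' x y c d : Carrier

  concordant-resp : p ≈ p' → q ≈ q' → Concordant p q → Concordant p' q'
  concordant-resp p≈p' q≈q' (inj₁ p≈ε) = inj₁ (trans (sym p≈p') p≈ε)
  concordant-resp p≈p' q≈q' (inj₂ (inj₁ q≈ε)) = inj₂ (inj₁ (trans (sym q≈q') q≈ε))
  concordant-resp p≈p' q≈q' (inj₂ (inj₂ p≈q)) = inj₂ (inj₂ (trans (sym p≈p') (trans p≈q q≈q')))

  concordant-sym : Concordant p q → Concordant q p
  concordant-sym (inj₁ p≈ε) = inj₂ (inj₁ p≈ε)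
  concordant-sym (inj₂ (inj₁ q≈ε)) = inj₁ q≈ε
  concordant-sym (inj₂ (inj₂ p≈q)) = inj₂ (inj₂ (sym p≈q))

  concordant⇒≈ : ¬ p ≈ ε → ¬ q ≈ ε → Concordant p q → p ≈ q
  concordant⇒≈ p≉ε _ (inj₁ p≈ε) = ⊥-elim (p≉ε p≈ε)
  concordant⇒≈ _ q≉ε (inj₂ (inj₁ q≈ε)) = ⊥-elim (q≉ε q≈ε)
  concordant⇒≈ _ _ (inj₂ (inj₂ p≈q)) = p≈q

  concordant-∙⁻¹ : ¬ x ≈ ε → ¬ y ≈ ε → Concordant x (x ∙ y ⁻¹) → x ≈ y
  concordant-∙⁻¹ x≉ε _ (inj₁ x≈ε) = ⊥-elim (x≉ε x≈ε)
  concordant-∙⁻¹ _ _ (inj₂ (inj₁ x∙y⁻¹≈ε)) = x∙y⁻¹≈ε⇒x≈y _ _ x∙y⁻¹≈ε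
  concordant-∙⁻¹ _ y≉ε (inj₂ (inj₂ x≈x∙y⁻¹)) = ⊥-elim (y≉ε (x∙y⁻¹≈x⇒y≈ε (sym x≈x∙y⁻¹)))

  Anchored : Carrier → Carrier → Carrier → Set ℓ
  Anchored c x y = x ≈ c ⊎ (x ≈ c ∙ c × y ≈ c)

  -- The hypotheses say that (x , y) is adjacent, in the two-coordinate graph, to (c , ε) and (c , c).
  concordant⇒anchored : ¬ c ≈ ε → ¬ (x ≈ ε × y ≈ ε) →
    Concordant (x ∙ c ⁻¹) y → Concordant (x ∙ c ⁻¹) (y ∙ c ⁻¹) → Anchored c x y
  concordant⇒anchored _ _ (inj₁ x∙c⁻¹≈ε) _ = inj₁ (x∙y⁻¹≈ε⇒x≈y _ _ x∙c⁻¹≈ε)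
  concordant⇒anchored _ _ _ (inj₁ x∙c⁻¹≈ε) = inj₁ (x∙y⁻¹≈ε⇒x≈y _ _ x∙c⁻¹≈ε)
  concordant⇒anchored c≉ε _ (inj₂ (inj₁ y≈ε)) (inj₂ (inj₁ y∙c⁻¹≈ε)) =
    ⊥-elim (c≉ε (trans (sym (x∙y⁻¹≈ε⇒x≈y _ _ y∙c⁻¹≈ε)) y≈ε))
  concordant⇒anchored {c} _ xy≉ε (inj₂ (inj₁ y≈ε)) (inj₂ (inj₂ x∙c⁻¹≈y∙c⁻¹)) =
    ⊥-elim (xy≉ε (trans (∙-cancelʳ (c ⁻¹) _ _ x∙c⁻¹≈y∙c⁻¹) y≈ε , y≈ε))
  concordant⇒anchored {c} {x} {y} _ _ (inj₂ (inj₂ x∙c⁻¹≈y)) (inj₂ (inj₁ y∙c⁻¹≈ε)) =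
    inj₂ (x≈c∙c , y≈c)
    where
    y≈c : y ≈ c
    y≈c = x∙y⁻¹≈ε⇒x≈y _ _ y∙c⁻¹≈ε
    x≈c∙c : x ≈ c ∙ c
    x≈c∙c = trans (sym (//-rightDividesˡ c x)) (∙-congʳ (trans x∙c⁻¹≈y y≈c))
  concordant⇒anchored c≉ε _ (inj₂ (inj₂ x∙c⁻¹≈y)) (inj₂ (inj₂ x∙c⁻¹≈y∙c⁻¹)) =
    ⊥-elim (c≉ε (x∙y⁻¹≈x⇒y≈ε (trans (sym x∙c⁻¹≈y∙c⁻¹) x∙c⁻¹≈y)))

  anchored-quotient : ¬ c ≈ ε → ¬ d ≈ ε → ¬ c ≈ d → ¬ p ≈ d →
    Anchored c x y → Anchored d y x → Concordant x (y ∙ p ⁻¹) → p ≈ c ⁻¹ ∙ d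
  anchored-quotient c≉ε _ _ _ (inj₁ x≈c) (inj₁ _) (inj₁ x≈ε) =
    ⊥-elim (c≉ε (trans (sym x≈c) x≈ε))
  anchored-quotient _ _ _ p≉d (inj₁ _) (inj₁ y≈d) (inj₂ (inj₁ y∙p⁻¹≈ε)) =
    ⊥-elim (p≉d (trans (sym (x∙y⁻¹≈ε⇒x≈y _ _ y∙p⁻¹≈ε)) y≈d))
  anchored-quotient {c} {d} {p} _ _ _ _ (inj₁ x≈c) (inj₁ y≈d) (inj₂ (inj₂ x≈y∙p⁻¹)) =
    y≈x\\z c p d (trans (∙-congʳ (sym x≈c)) (trans (x≈z∙y⁻¹⇒x∙y≈z x≈y∙p⁻¹) y≈d))
  anchored-quotient _ _ c≉d _ (inj₁ x≈c) (inj₂ (_ , x≈d)) _ =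
    ⊥-elim (c≉d (trans (sym x≈c) x≈d))
  anchored-quotient _ _ c≉d _ (inj₂ (_ , y≈c)) (inj₁ y≈d) _ =
    ⊥-elim (c≉d (trans (sym y≈c) y≈d))
  anchored-quotient _ d≉ε _ _ (inj₂ _) (inj₂ (_ , x≈d)) (inj₁ x≈ε) =
    ⊥-elim (d≉ε (trans (sym x≈d) x≈ε))
  anchored-quotient {c} _ _ _ _ (inj₂ (x≈c∙c , y≈c)) (inj₂ (_ , x≈d)) (inj₂ (inj₁ y∙p⁻¹≈ε)) =
    trans (sym (x∙y⁻¹≈ε⇒x≈y _ _ y∙p⁻¹≈ε))
      (trans y≈c (trans (sym (\\-leftDividesʳ c c)) (∙-congˡ (trans (sym x≈c∙c) x≈d))))
  anchored-quotient {c} {d} {p} _ _ _ p≉d (inj₂ _) (inj₂ (y≈d∙d , x≈d)) (inj₂ (inj₂ x≈y∙p⁻¹)) =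
    ⊥-elim (p≉d (∙-cancelˡ d p d d∙p≈d∙d))
    where
    d∙p≈d∙d : d ∙ p ≈ d ∙ d
    d∙p≈d∙d = trans (∙-congʳ (sym x≈d)) (trans (x≈z∙y⁻¹⇒x∙y≈z x≈y∙p⁻¹) y≈d∙d)

module Tuples {a ℓ} (G : Group a ℓ) (m : ℕ) where
  open Group G
  open Concordance G

  infix 4 _≋_
  _≋_ : Tuple G m → Tuple G m → Set ℓ
  _≋_ = _≈ᵗ_ G m

  private variable t t' : Tuple G m

  intervalElem-values : ∀ k l x j → intervalElem G m k l x j ≡ x ⊎ intervalElem G m k l x j ≡ ε
  intervalElem-values k l x j with (k ≤? toℕ j) ×-dec (toℕ j <? l)
  ... | yes _ = inj₁ ≡.refl
  ... | no _ = inj₂ ≡.refl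

  InS-cong : t ≋ t' → InS G m t → InS G m t'
  InS-cong t≋t' (k , l , valid , x , x≉ε , t≋xₖₗ) =
    k , l , valid , x , x≉ε , λ j → trans (sym (t≋t' j)) (t≋xₖₗ j)

  InS⇒concordant : InS G m t → ∀ i j → Concordant (t i) (t j)
  InS⇒concordant {t} (k , l , _ , x , _ , t≋xₖₗ) i j
    with intervalElem-values k l x i | intervalElem-values k l x j
  ... | inj₂ tᵢ≡ε | _ = inj₁ (trans (t≋xₖₗ i) (reflexive tᵢ≡ε))
  ... | _ | inj₂ tⱼ≡ε = inj₂ (inj₁ (trans (t≋xₖₗ j) (reflexive tⱼ≡ε)))
  ... | inj₁ tᵢ≡x | inj₁ tⱼ≡x =
    inj₂ (inj₂ (trans (trans (t≋xₖₗ i) (reflexive tᵢ≡x))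
                      (sym (trans (t≋xₖₗ j) (reflexive tⱼ≡x)))))

module Pairs {a ℓ} (G : Group a ℓ) (m : ℕ) where
  open Group G
  open GroupProperties G
  open Tuples G (suc (suc m)) public

  M : ℕ
  M = suc (suc m)

  private variable p p' q q' x : Carrier

  pair : Carrier → Carrier → Tuple G M
  pair p q zero = p
  pair p q (suc zero) = q
  pair p q (suc (suc _)) = ε

  pair-cong : p ≈ p' → q ≈ q' → pair p q ≋ pair p' q'
  pair-cong p≈p' _ zero = p≈p'
  pair-cong _ q≈q' (suc zero) = q≈q'
  pair-cong _ _ (suc (suc _)) = refl

  pair-ε : p ≈ ε → q ≈ ε → pair p q ≋ eᵗ G M
  pair-ε p≈ε _ zero = p≈ε
  pair-ε _ q≈ε (suc zero) = q≈ε
  pair-ε _ _ (suc (suc _)) = refl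

  valid₀₁ : ValidInterval G M 0 1
  valid₀₁ = s≤s z≤n , s≤s z≤n

  valid₁₂ : ValidInterval G M 1 2
  valid₁₂ = s≤s (s≤s z≤n) , s≤s (s≤s z≤n)

  valid₀₂ : ValidInterval G M 0 2
  valid₀₂ = s≤s z≤n , s≤s (s≤s z≤n)

  interval₀₁≋pair : ∀ x → intervalElem G M 0 1 x ≋ pair x ε
  interval₀₁≋pair x = λ { zero → refl ; (suc zero) → refl ; (suc (suc _)) → refl }

  interval₁₂≋pair : ∀ x → intervalElem G M 1 2 x ≋ pair ε x
  interval₁₂≋pair x = λ { zero → refl ; (suc zero) → refl ; (suc (suc _)) → refl }

  interval₀₂≋pair : ∀ x → intervalElem G M 0 2 x ≋ pair x x
  interval₀₂≋pair x = λ { zero → refl ; (suc zero) → refl ; (suc (suc _)) → refl }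

  InInterval-pair₀₁ : ¬ x ≈ ε → p ≈ x → q ≈ ε → InInterval G M 0 1 (pair p q)
  InInterval-pair₀₁ {x} x≉ε p≈x q≈ε =
    x , x≉ε , λ j → trans (pair-cong p≈x q≈ε j) (sym (interval₀₁≋pair x j))

  InInterval-pair₁₂ : ¬ x ≈ ε → p ≈ ε → q ≈ x → InInterval G M 1 2 (pair p q)
  InInterval-pair₁₂ {x} x≉ε p≈ε q≈x =
    x , x≉ε , λ j → trans (pair-cong p≈ε q≈x j) (sym (interval₁₂≋pair x j))

  InInterval-pair₀₂ : ¬ x ≈ ε → p ≈ x → q ≈ x → InInterval G M 0 2 (pair p q)
  InInterval-pair₀₂ {x} x≉ε p≈x q≈x =
    x , x≉ε , λ j → trans (pair-cong p≈x q≈x j) (sym (interval₀₂≋pair x j))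

  InS-pair₀₁ : ¬ x ≈ ε → p ≈ x → q ≈ ε → InS G M (pair p q)
  InS-pair₀₁ x≉ε p≈x q≈ε = 0 , 1 , valid₀₁ , InInterval-pair₀₁ x≉ε p≈x q≈ε

  InS-pair₁₂ : ¬ x ≈ ε → p ≈ ε → q ≈ x → InS G M (pair p q)
  InS-pair₁₂ x≉ε p≈ε q≈x = 1 , 2 , valid₁₂ , InInterval-pair₁₂ x≉ε p≈ε q≈x

  InS-pair₀₂ : ¬ x ≈ ε → p ≈ x → q ≈ x → InS G M (pair p q)
  InS-pair₀₂ x≉ε p≈x q≈x = 0 , 2 , valid₀₂ , InInterval-pair₀₂ x≉ε p≈x q≈x

  pair-adjacent : InS G M (pair (p' ∙ p ⁻¹) (q' ∙ q ⁻¹)) → Adj G M (pair p q) (pair p' q')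
  pair-adjacent = InS-cong λ { zero → refl ; (suc zero) → refl ; (suc (suc _)) → sym (inverseʳ ε) }

  pair-adjacentˡ : ¬ p ≈ p' → Adj G M (pair p q) (pair p' q)
  pair-adjacentˡ {p} {p'} {q} p≉p' =
    pair-adjacent (InS-pair₀₁ (p≉p' ∘ sym ∘ x∙y⁻¹≈ε⇒x≈y p' p) refl (inverseʳ q))

  pair-adjacentʳ : ¬ q ≈ q' → Adj G M (pair p q) (pair p q')
  pair-adjacentʳ {q} {q'} {p} q≉q' =
    pair-adjacent (InS-pair₁₂ (q≉q' ∘ sym ∘ x∙y⁻¹≈ε⇒x≈y q' q) (inverseʳ p) refl)

  pair-adjacent-diagonal : ¬ x ≈ ε → p' ≈ x ∙ p → q' ≈ x ∙ q → Adj G M (pair p q) (pair p' q')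
  pair-adjacent-diagonal {x} {p'} {p} {q'} {q} x≉ε p'≈x∙p q'≈x∙q =
    pair-adjacent (InS-pair₀₂ x≉ε (trans (∙-congʳ p'≈x∙p) (//-rightDividesʳ p x))
                                 (trans (∙-congʳ q'≈x∙q) (//-rightDividesʳ q x)))

  interval-head : ∀ {k l t} → ValidInterval G M k l → InInterval G M k l t →
                  ¬ t zero ≈ ε → t (suc zero) ≈ ε → k ≡ 0 × l ≡ 1
  interval-head {suc k} _ (_ , _ , t≋xₖₗ) t₀≉ε _ = ⊥-elim (t₀≉ε (t≋xₖₗ zero))
  interval-head {zero} {zero} (() , _) _ _ _
  interval-head {zero} {suc zero} _ _ _ _ = ≡.refl , ≡.refl
  interval-head {zero} {suc (suc l)} _ (_ , x≉ε , t≋xₖₗ) _ t₁≈ε =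
    ⊥-elim (x≉ε (trans (sym (t≋xₖₗ (suc zero))) t₁≈ε))

  InS-head : ∀ {t} → InS G M t → ¬ t zero ≈ ε → t (suc zero) ≈ ε → ∀ j → t (suc (suc j)) ≈ ε
  InS-head (k , l , valid , t∈Sₖₗ) t₀≉ε t₁≈ε j with interval-head valid t∈Sₖₗ t₀≉ε t₁≈ε
  ... | ≡.refl , ≡.refl = proj₂ (proj₂ t∈Sₖₗ) (suc (suc j))

module Forward {a ℓ a' ℓ'} (G : Group a ℓ) (H : Group a' ℓ')
  (_≟ᴳ_ : Decidable (Group._≈_ G)) (_≟ᴴ_ : Decidable (Group._≈_ H))
  (m : ℕ) (F : GraphIso G H (suc (suc m))) (homogeneous : IsHomogeneous G H (suc (suc m)) F) where

  module G where
    open Group G public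
    open GroupProperties G public
    open GroupFacts G public
    open Concordance G public
    open Pairs G m public
  open Group H
  open GroupProperties H
  open GroupFacts H
  open Concordance H
  open Pairs H m
  open GraphIso F
  open import Relation.Binary.Reasoning.Setoid setoid

  private variable
    x y : G.Carrier
    g g' : Tuple G M
    u u' : Tuple H M

  to-ε : to (eᵗ G M) ≋ eᵗ H M
  to-ε = proj₁ homogeneous

  to-injective : to g ≋ to g' → g G.≋ g'
  to-injective {g} {g'} to-g≋to-g' j =
    G.trans (G.sym (from-to g j)) (G.trans (from-cong to-g≋to-g' j) (from-to g' j))

  to-identity : g G.≋ eᵗ G M → u ≋ eᵗ H M → to g ≋ u
  to-identity g≋e u≋e j = trans (to-cong g≋e j) (trans (to-ε j) (sym (u≋e j)))

  adjacent-images : Adj G M g g' → to g ≋ u → to g' ≋ u' → Adj H M u u'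
  adjacent-images {g} {g'} g∼g' to-g≋u to-g'≋u' =
    InS-cong (λ j → ∙-cong (to-g'≋u' j) (⁻¹-cong (to-g≋u j))) (adj-iff₁ g g' g∼g')

  images-concordant : Adj G M g g' → to g ≋ u → to g' ≋ u' →
    Concordant (u' zero ∙ u zero ⁻¹) (u' (suc zero) ∙ u (suc zero) ⁻¹)
  images-concordant g∼g' to-g≋u to-g'≋u' =
    InS⇒concordant (adjacent-images g∼g' to-g≋u to-g'≋u') zero (suc zero)

  φ : G.Carrier → Carrier
  φ x = to (G.pair x G.ε) zero

  φ-cong : x G.≈ y → φ x ≈ φ y
  φ-cong x≈y = to-cong (G.pair-cong x≈y G.refl) zero

  φ-ε : x G.≈ G.ε → φ x ≈ ε
  φ-ε x≈ε = to-identity (G.pair-ε x≈ε G.refl) (λ _ → refl) zero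

  image₀₁ : ∀ x → to (G.pair x G.ε) ≋ pair (φ x) ε
  image₀₁ x with x ≟ᴳ G.ε
  ... | yes x≈ε = to-identity (G.pair-ε x≈ε G.refl) (pair-ε (φ-ε x≈ε) refl)
  ... | no x≉ε with proj₂ homogeneous 0 1 G.valid₀₁ _ (G.InInterval-pair₀₁ x≉ε G.refl G.refl)
  ...   | z , _ , image≋z = λ j →
    trans (image≋z j) (trans (interval₀₁≋pair z j) (pair-cong (sym (image≋z zero)) refl j))

  φ-injective : φ x ≈ φ y → x G.≈ y
  φ-injective {x} {y} φx≈φy =
    to-injective (λ j → trans (image₀₁ x j) (trans (pair-cong φx≈φy refl j) (sym (image₀₁ y j)))) zero

  φ-nonidentity : ¬ x G.≈ G.ε → ¬ φ x ≈ ε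
  φ-nonidentity x≉ε φx≈ε = x≉ε (φ-injective (trans φx≈ε (sym (φ-ε G.refl))))

  image₀₂ : ∀ x → to (G.pair x x) ≋ pair (φ x) (φ x)
  image₀₂ x with x ≟ᴳ G.ε
  ... | yes x≈ε = to-identity (G.pair-ε x≈ε x≈ε) (pair-ε (φ-ε x≈ε) (φ-ε x≈ε))
  ... | no x≉ε with proj₂ homogeneous 0 2 G.valid₀₂ _ (G.InInterval-pair₀₂ x≉ε G.refl G.refl)
  ...   | z , z≉ε , image≋z = λ j → trans (image≋pair j) (pair-cong z≈φx z≈φx j)
    where
    image≋pair : to (G.pair x x) ≋ pair z z
    image≋pair j = trans (image≋z j) (interval₀₂≋pair z j)
    z≈φx : z ≈ φ x
    z≈φx = concordant-∙⁻¹ z≉ε (φ-nonidentity x≉ε) (concordant-sym (concordant-resp refl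
      (x∙ε⁻¹≈x z) (images-concordant (G.pair-adjacentʳ (x≉ε ∘ G.sym)) (image₀₁ x) image≋pair)))

  image₁₂ : ∀ x → to (G.pair G.ε x) ≋ pair ε (φ x)
  image₁₂ x with x ≟ᴳ G.ε
  ... | yes x≈ε = to-identity (G.pair-ε G.refl x≈ε) (pair-ε refl (φ-ε x≈ε))
  ... | no x≉ε with proj₂ homogeneous 1 2 G.valid₁₂ _ (G.InInterval-pair₁₂ x≉ε G.refl G.refl)
  ...   | z , z≉ε , image≋z = λ j → trans (image≋pair j) (pair-cong refl (sym φx≈z) j)
    where
    image≋pair : to (G.pair G.ε x) ≋ pair ε z
    image≋pair j = trans (image≋z j) (interval₁₂≋pair z j)
    φx≈z : φ x ≈ z
    φx≈z = concordant-∙⁻¹ (φ-nonidentity x≉ε) z≉ε (concordant-resp (x∙ε⁻¹≈x (φ x)) refl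
      (images-concordant (G.pair-adjacentˡ (x≉ε ∘ G.sym)) image≋pair (image₀₂ x)))

  φ-⁻¹ : ∀ x → φ (x G.⁻¹) ≈ φ x ⁻¹
  φ-⁻¹ x with x ≟ᴳ G.ε
  ... | yes x≈ε = trans (φ-ε (G.trans (G.⁻¹-cong x≈ε) G.ε⁻¹≈ε))
                        (sym (trans (⁻¹-cong (φ-ε x≈ε)) ε⁻¹≈ε))
  ... | no x≉ε = sym (concordant⇒≈ (x≉ε⇒x⁻¹≉ε (φ-nonidentity x≉ε)) (φ-nonidentity x⁻¹≉ε)
    (concordant-resp (identityˡ _) (x∙ε⁻¹≈x _)
      (images-concordant x,ε∼ε,x⁻¹ (image₀₁ x) (image₁₂ (x G.⁻¹)))))
    where
    x⁻¹≉ε : ¬ x G.⁻¹ G.≈ G.ε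
    x⁻¹≉ε = G.x≉ε⇒x⁻¹≉ε x≉ε
    x,ε∼ε,x⁻¹ : Adj G M (G.pair x G.ε) (G.pair G.ε (x G.⁻¹))
    x,ε∼ε,x⁻¹ = G.pair-adjacent-diagonal x⁻¹≉ε (G.sym (G.inverseˡ x)) (G.sym (G.identityʳ _))

  image-nonvanishing : ¬ x G.≈ G.ε → ¬ y G.≈ G.ε →
    ¬ (to (G.pair x y) zero ≈ ε × to (G.pair x y) (suc zero) ≈ ε)
  image-nonvanishing {x} {y} x≉ε y≉ε (h₀≈ε , h₁≈ε) =
    x≉ε (to-injective (λ j → trans (h≋e j) (sym (to-ε j))) zero)
    where
    h : Tuple H M
    h = to (G.pair x y)
    h₀∙φx⁻¹≉ε : ¬ h zero ∙ φ x ⁻¹ ≈ ε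
    h₀∙φx⁻¹≉ε e = x≉ε⇒x⁻¹≉ε (φ-nonidentity x≉ε)
      (trans (sym (identityˡ _)) (trans (∙-congʳ (sym h₀≈ε)) e))
    -- h ∙ (φ x , ε , ε , …)⁻¹ lies in S and begins with (φ x ⁻¹ , ε), so it is a [0,1)-interval element.
    tail : ∀ j → h (suc (suc j)) ∙ ε ⁻¹ ≈ ε
    tail = InS-head (adjacent-images (G.pair-adjacentʳ (y≉ε ∘ G.sym)) (image₀₁ x) (λ _ → refl))
             h₀∙φx⁻¹≉ε (trans (x∙ε⁻¹≈x _) h₁≈ε)
    h≋e : h ≋ eᵗ H M
    h≋e zero = h₀≈ε
    h≋e (suc zero) = h₁≈ε
    h≋e (suc (suc j)) = trans (sym (x∙ε⁻¹≈x _)) (tail j)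

  image-anchoredˡ : ¬ x G.≈ G.ε → ¬ y G.≈ G.ε → ¬ x G.≈ y →
    Anchored (φ x) (to (G.pair x y) zero) (to (G.pair x y) (suc zero))
  image-anchoredˡ {x} {y} x≉ε y≉ε x≉y =
    concordant⇒anchored (φ-nonidentity x≉ε) (image-nonvanishing x≉ε y≉ε)
      (concordant-resp refl (x∙ε⁻¹≈x _)
        (images-concordant (G.pair-adjacentʳ (y≉ε ∘ G.sym)) (image₀₁ x) (λ _ → refl)))
      (images-concordant (G.pair-adjacentʳ x≉y) (image₀₂ x) (λ _ → refl))

  image-anchoredʳ : ¬ x G.≈ G.ε → ¬ y G.≈ G.ε → ¬ x G.≈ y →
    Anchored (φ y) (to (G.pair x y) (suc zero)) (to (G.pair x y) zero)
  image-anchoredʳ {x} {y} x≉ε y≉ε x≉y =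
    concordant⇒anchored (φ-nonidentity y≉ε) (image-nonvanishing x≉ε y≉ε ∘ swap)
      (concordant-sym (concordant-resp (x∙ε⁻¹≈x _) refl
        (images-concordant (G.pair-adjacentˡ (x≉ε ∘ G.sym)) (image₁₂ y) (λ _ → refl))))
      (concordant-sym
        (images-concordant (G.pair-adjacentˡ (x≉y ∘ G.sym)) (image₀₂ y) (λ _ → refl)))

  image-concordant-quotient : ¬ x G.≈ G.ε →
    Concordant (to (G.pair x y) zero) (to (G.pair x y) (suc zero) ∙ φ (x G.⁻¹ G.∙ y) ⁻¹)
  image-concordant-quotient {x} {y} x≉ε =
    concordant-resp (x∙ε⁻¹≈x _) refl
      (images-concordant ε,x⁻¹y∼x,y (image₁₂ (x G.⁻¹ G.∙ y)) (λ _ → refl))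
    where
    ε,x⁻¹y∼x,y : Adj G M (G.pair G.ε (x G.⁻¹ G.∙ y)) (G.pair x y)
    ε,x⁻¹y∼x,y = G.pair-adjacent-diagonal x≉ε (G.sym (G.identityʳ x)) (G.sym (G.\\-leftDividesˡ x y))

  φ-quotient : ¬ x G.≈ G.ε → ¬ y G.≈ G.ε → ¬ x G.≈ y → φ (x G.⁻¹ G.∙ y) ≈ φ x ⁻¹ ∙ φ y
  φ-quotient {x} {y} x≉ε y≉ε x≉y =
    anchored-quotient (φ-nonidentity x≉ε) (φ-nonidentity y≉ε) (x≉y ∘ φ-injective) φ[x⁻¹y]≉φy
      (image-anchoredˡ x≉ε y≉ε x≉y) (image-anchoredʳ x≉ε y≉ε x≉y) (image-concordant-quotient x≉ε)
    where
    φ[x⁻¹y]≉φy : ¬ φ (x G.⁻¹ G.∙ y) ≈ φ y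
    φ[x⁻¹y]≉φy e = x≉ε (G.x⁻¹≈ε⇒x≈ε (G.identityˡ-unique (x G.⁻¹) y (φ-injective e)))

  φ-∙ : ∀ x y → φ (x G.∙ y) ≈ φ x ∙ φ y
  φ-∙ x y with x ≟ᴳ G.ε | y ≟ᴳ G.ε | (x G.∙ y) ≟ᴳ G.ε
  ... | yes x≈ε | _ | _ = begin
    φ (x G.∙ y)  ≈⟨ φ-cong (G.trans (G.∙-congʳ x≈ε) (G.identityˡ y)) ⟩
    φ y          ≈⟨ identityˡ (φ y) ⟨
    ε ∙ φ y      ≈⟨ ∙-congʳ (φ-ε x≈ε) ⟨
    φ x ∙ φ y    ∎
  ... | no _ | yes y≈ε | _ = begin
    φ (x G.∙ y)  ≈⟨ φ-cong (G.trans (G.∙-congˡ y≈ε) (G.identityʳ x)) ⟩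
    φ x          ≈⟨ identityʳ (φ x) ⟨
    φ x ∙ ε      ≈⟨ ∙-congˡ (φ-ε y≈ε) ⟨
    φ x ∙ φ y    ∎
  ... | no _ | no _ | yes x∙y≈ε = begin
    φ (x G.∙ y)       ≈⟨ φ-ε x∙y≈ε ⟩
    ε                 ≈⟨ inverseʳ (φ x) ⟨
    φ x ∙ φ x ⁻¹      ≈⟨ ∙-congˡ (φ-⁻¹ x) ⟨
    φ x ∙ φ (x G.⁻¹)  ≈⟨ ∙-congˡ (φ-cong (G.inverseʳ-unique x y x∙y≈ε)) ⟨
    φ x ∙ φ y         ∎
  ... | no x≉ε | no y≉ε | no x∙y≉ε = begin
    φ (x G.∙ y)                ≈⟨ φ-cong (G.∙-congʳ (G.⁻¹-involutive x)) ⟨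
    φ (x G.⁻¹ G.⁻¹ G.∙ y)      ≈⟨ φ-quotient (G.x≉ε⇒x⁻¹≉ε x≉ε) y≉ε x⁻¹≉y ⟩
    φ (x G.⁻¹) ⁻¹ ∙ φ y        ≈⟨ ∙-congʳ (⁻¹-cong (φ-⁻¹ x)) ⟩
    φ x ⁻¹ ⁻¹ ∙ φ y            ≈⟨ ∙-congʳ (⁻¹-involutive (φ x)) ⟩
    φ x ∙ φ y                  ∎
    where
    x⁻¹≉y : ¬ x G.⁻¹ G.≈ y
    x⁻¹≉y x⁻¹≈y = x∙y≉ε (G.trans (G.∙-congˡ (G.sym x⁻¹≈y)) (G.inverseʳ x))

  φ-surjective : ∀ y → Σ G.Carrier λ x → ∀ {z} → z G.≈ x → φ z ≈ y
  φ-surjective y with y ≟ᴴ ε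
  ... | yes y≈ε = G.ε , λ z≈ε → trans (φ-ε z≈ε) (sym y≈ε)
  ... | no y≉ε = preimage (G.InS-cong (λ j → G.x∙ε⁻¹≈x (s j)) (adj-iff₂ (eᵗ G M) s e∼s))
    where
    s : Tuple G M
    s = from (pair y ε)
    to-s≋ : to s ≋ pair y ε
    to-s≋ = to-from (pair y ε)
    e∼s : Adj H M (to (eᵗ G M)) (to s)
    e∼s = InS-cong (λ j → trans (sym (x∙ε⁻¹≈x _)) (∙-cong (sym (to-s≋ j)) (⁻¹-cong (sym (to-ε j)))))
            (InS-pair₀₁ y≉ε refl refl)
    -- Homogeneity puts to s = (y , ε , ε , …) in the same interval as s, which must thus be [0,1).
    preimage : InS G M s → Σ G.Carrier λ x → ∀ {z} → z G.≈ x → φ z ≈ y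
    preimage (k , l , valid , s∈Sₖₗ@(x , _ , s≋xₖₗ))
      with interval-head valid (proj₂ homogeneous k l valid s s∈Sₖₗ)
                         (y≉ε ∘ trans (sym (to-s≋ zero))) (to-s≋ (suc zero))
    ... | ≡.refl , ≡.refl = x , λ z≈x → trans (to-cong (pair≋s z≈x) zero) (to-s≋ zero)
      where
      pair≋s : ∀ {z} → z G.≈ x → G.pair z G.ε G.≋ s
      pair≋s z≈x j = G.trans (G.pair-cong z≈x G.refl j)
                       (G.trans (G.sym (G.interval₀₁≋pair x j)) (G.sym (s≋xₖₗ j)))

  groupIsomorphic : GroupIsomorphic G H
  groupIsomorphic = φ , record
    { isGroupMonomorphism = record
      { isGroupHomomorphism = record
        { isMonoidHomomorphism = record
          { isMagmaHomomorphism = record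
            { isRelHomomorphism = record { cong = φ-cong }
            ; homo = φ-∙
            }
          ; ε-homo = φ-ε G.refl
          }
        ; ⁻¹-homo = φ-⁻¹
        }
      ; injective = φ-injective
      }
    ; surjective = φ-surjective
    }

module Backward {a ℓ a' ℓ'} (G : Group a ℓ) (H : Group a' ℓ') (m : ℕ)
  (ψ : Group.Carrier G → Group.Carrier H)
  (isIsomorphism : GroupMorphisms.IsGroupIsomorphism (Group.rawGroup G) (Group.rawGroup H) ψ) where

  module G where
    open Group G public
    open Tuples G m public
  open Group H
  open Tuples H m
  open GroupMorphisms.IsGroupIsomorphism isIsomorphism

  private variable
    k l : ℕ
    x : G.Carrier
    y : Carrier
    t : Tuple G m

  ψ⁻¹ : Carrier → G.Carrier
  ψ⁻¹ y = proj₁ (surjective y)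

  ψ∘ψ⁻¹ : ∀ y → ψ (ψ⁻¹ y) ≈ y
  ψ∘ψ⁻¹ y = proj₂ (surjective y) G.refl

  ψ-nonidentity : ¬ x G.≈ G.ε → ¬ ψ x ≈ ε
  ψ-nonidentity x≉ε ψx≈ε = x≉ε (injective (trans ψx≈ε (sym ε-homo)))

  ψ-intervalElem : ∀ k l j → ψ x ≈ y → ψ (intervalElem G m k l x j) ≈ intervalElem H m k l y j
  ψ-intervalElem k l j ψx≈y with (k ≤? toℕ j) ×-dec (toℕ j <? l)
  ... | yes _ = ψx≈y
  ... | no _ = ε-homo

  ψ-InInterval : InInterval G m k l t → InInterval H m k l (ψ ∘ t)
  ψ-InInterval {k} {l} (x , x≉ε , t≋xₖₗ) =
    ψ x , ψ-nonidentity x≉ε , λ j → trans (⟦⟧-cong (t≋xₖₗ j)) (ψ-intervalElem k l j refl)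

  ψ-InInterval⁻¹ : InInterval H m k l (ψ ∘ t) → InInterval G m k l t
  ψ-InInterval⁻¹ {k} {l} (y , y≉ε , ψt≋yₖₗ) =
    ψ⁻¹ y , ψ⁻¹y≉ε , λ j → injective (trans (ψt≋yₖₗ j) (sym (ψ-intervalElem k l j (ψ∘ψ⁻¹ y))))
    where
    ψ⁻¹y≉ε : ¬ ψ⁻¹ y G.≈ G.ε
    ψ⁻¹y≉ε e = y≉ε (trans (sym (ψ∘ψ⁻¹ y)) (trans (⟦⟧-cong e) ε-homo))

  InS-ψ : InS G m t ⇔ InS H m (ψ ∘ t)
  InS-ψ = mk⇔ (λ (k , l , valid , t∈Sₖₗ) → k , l , valid , ψ-InInterval {k} {l} t∈Sₖₗ)
              (λ (k , l , valid , ψt∈Sₖₗ) → k , l , valid , ψ-InInterval⁻¹ {k} {l} ψt∈Sₖₗ)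

  ψ-quotient : ∀ (g g' : Tuple G m) →
    ψ ∘ _·ᵗ_ G m g' (invᵗ G m g) ≋ _·ᵗ_ H m (ψ ∘ g') (invᵗ H m (ψ ∘ g))
  ψ-quotient g g' j = trans (∙-homo (g' j) (g j G.⁻¹)) (∙-congˡ (⁻¹-homo (g j)))

  graphIso : GraphIso G H m
  graphIso = record
    { to        = ψ ∘_
    ; from      = ψ⁻¹ ∘_
    ; to-cong   = λ g≋g' j → ⟦⟧-cong (g≋g' j)
    ; from-cong = λ {h} {h'} h≋h' j →
                    injective (trans (ψ∘ψ⁻¹ (h j)) (trans (h≋h' j) (sym (ψ∘ψ⁻¹ (h' j)))))
    ; to-from   = λ h j → ψ∘ψ⁻¹ (h j)
    ; from-to   = λ g j → injective (ψ∘ψ⁻¹ (ψ (g j)))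
    ; adj-iff₁  = λ g g' g∼g' → InS-cong (ψ-quotient g g') (Equivalence.to InS-ψ g∼g')
    ; adj-iff₂  = λ g g' ψg∼ψg' → Equivalence.from InS-ψ (InS-cong (sym ∘ ψ-quotient g g') ψg∼ψg')
    }

  homogeneousGraphIsomorphic : HomogeneousGraphIsomorphic G H m
  homogeneousGraphIsomorphic = graphIso , (λ _ → ε-homo) , λ k l _ _ → ψ-InInterval {k} {l}

corollary5p3 : ∀ {c ℓ c' ℓ'} (G : Group c ℓ) (H : Group c' ℓ') → IsFiniteGroup G → IsFiniteGroup H →
    (m : ℕ) → 2 ≤ m → (HomogeneousGraphIsomorphic G H m ⇔ GroupIsomorphic G H)
corollary5p3 G H finiteG finiteH (suc (suc m)) (s≤s (s≤s _)) = mk⇔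
  (λ (F , homogeneous) →
     Forward.groupIsomorphic G H (finite⇒≟ G finiteG) (finite⇒≟ H finiteH) m F homogeneous)
  (λ (ψ , isIsomorphism) → Backward.homogeneousGraphIsomorphic G H (suc (suc m)) ψ isIsomorphism)
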